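{- Let $\mathcal{G}=(\Sigma,\mathcal{N},\mathcal{R},X_{\mathsf{st}})$ be a recursion scheme. For every nonterminal $X\in\mathcal{N}$ and every type pair $(f,\tau)$ with $f\in\{\mathsf{pr},\mathsf{np}\}$ and $\tau$ a type of the sort of $X$: the judgment $\emptyset\vdash\Lambda_{\mathcal{G}}(X):(v,\tau)$ is derivable for some $v$ with $\mathfrak{p}(v)=f$ if and only if $(X:(f,\tau))\in\mathcal{T}_{\mathcal{G}}$.
   Context: Sorts are built from $\mathsf{o}$ by $\to$. Lambda-terms are (possibly infinitary) simply-typed lambda-terms, identified up to alpha-conversion, over constants $\mathsf{a}:\mathsf{o}\to\mathsf{o}$, $\mathsf{b}:\mathsf{o}\to\mathsf{o}\to\mathsf{o}$, $\mathsf{c}:\mathsf{o}$ (and $\omega:\mathsf{o}$). Recursion scheme $\mathcal{G}=(\Sigma,\mathcal{N},\mathcal{R},X_{\mathsf{st}})$: signature $\Sigma=\{\mathsf{a},\mathsf{b},\mathsf{c}\}$; a finite set $\mathcal{N}$ of nonterminals (distinguished variables with sorts, never used as bound variables); a map $\mathcal{R}$ assigning to each $X\in\mathcal{N}$ a finite lambda-term $\mathcal{R}(X)$ of the same sort as $X$, not itself a nonterminal, whose free variables are nonterminals, of the form $\lambda x_1.\cdots\lambda x_n.K$ with $K$ containing no lambda-binders; and $X_{\mathsf{st}}\in\mathcal{N}$ of sort $\mathsf{o}$. For a term $M$, $\Lambda_{\mathcal{G}}(M)$ is the limit of repeatedly replacing occurrences of nonterminals $X$ by $\mathcal{R}(X)$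 (so that every nonterminal occurrence is eventually replaced). Type system: $\mathcal{T}^{\mathsf{o}}=\{\mathsf{r}\}$, $\mathcal{T}^{\alpha\to\beta}=\mathcal{P}(\{\mathsf{pr},\mathsf{np}\}\times\mathcal{T}^\alpha)\times\mathcal{T}^\beta$, written $\bigwedge_{i\in I}(f_i,\tau_i)\to\tau$ (pairs distinct), $\top$ the empty conjunction. Judgments $\Gamma\vdash M:(v,\tau)$ with $v\in\mathbb{N}$; $\Gamma$ a finite set of bindings $x:(g,\sigma)$ (several per variable allowed); $\mathit{dom}(\Gamma)$ the bound variables; $\Gamma{\restriction}_{\mathsf{pr}}$ the bindings with flag $\mathsf{pr}$; $\mathit{dupl}((\Gamma_i)_{i\in J})=\sum_{i\in J}|\Gamma_i{\restriction}_{\mathsf{pr}}|-|\bigcup_{i\in J}\Gamma_i{\restriction}_{\mathsf{pr}}|$. Finite derivations use the rules: $\emptyset\vdash\mathsf{a}:(1,(f,\mathsf{r})\to\mathsf{r})$; $\emptyset\vdash\mathsf{c}:(0,\mathsf{r})$; $\emptyset\vdash\mathsf{b}:(0,(f,\mathsf{r})\to\top\to\mathsf{r})$; $\emptyset\vdash\mathsf{b}:(0,\top\to(f,\mathsf{r})\to\mathsf{r})$; $x:(f,\tau)\vdash x:(0,\tau)$; ($\lambda$): from $\Gamma\cup\{x:(f_i,\tau_i)\mid i\in I\}\vdash K:(v,\tau)$, $x\notin\mathit{dom}(\Gamma)$, infer $\Gamma\vdash\lambda x.K:(v,\bigwedge_{i\in I}(f_i,\tau_i)\to\tau)$; ($@$):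 if $0\notin I$, $\Gamma_0\vdash K:(v_0,\bigwedge_{i\in I}(f_i,\tau_i)\to\tau)$ and $\Gamma_i\vdash L:(v_i,\tau_i)$ for $i\in I$ with $f_i=\mathsf{pr}$ iff ($v_i>0$ or $\Gamma_i{\restriction}_{\mathsf{pr}}\ne\emptyset$), infer $\bigcup_{i\in\{0\}\cup I}\Gamma_i\vdash K\,L:(\mathit{dupl}((\Gamma_i)_{i\in\{0\}\cup I})+\sum_{i\in\{0\}\cup I}v_i,\tau)$. Let $\mathfrak{p}(v)=\mathsf{pr}$ if $v>0$ and $\mathfrak{p}(v)=\mathsf{np}$ if $v=0$. $\mathcal{T}_{\mathcal{G}}$ is the smallest set of bindings $X:(\mathfrak{p}(v),\tau)$ ($X\in\mathcal{N}$) such that $\emptyset\vdash\mathcal{R}(X):(v,\tau)$ is derivable when, besides the rules above, judgments $\emptyset\vdash Y:(w,\sigma)$ for nonterminals $Y$ with $(Y:(\mathfrak{p}(w),\sigma))\in\mathcal{T}_{\mathcal{G}}$ may be used as additional axioms. -}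

module Defs where

open import Data.Nat using (ℕ; zero; suc; _+_; _∸_; _<_)
open import Data.Bool using (Bool; true; false; _∨_)
open import Data.Fin as Fin using (Fin; zero; suc)
open import Data.List using (List; []; _∷_; length; lookup; cartesianProduct; map; concatMap)
open import Data.Vec using (Vec; []; _∷_; replicate; zipWith; tabulate)
open import Data.Product using (Σ; _×_; _,_; proj₁; proj₂)
open import Data.Sum using (_⊎_)
open import Data.Empty using (⊥; ⊥-elim)
open import Relation.Nullary using (¬_; does)
open import Relation.Binary.PropositionalEquality using (_≡_; _≢_)
open import Function.Bundles using (_⇔_)

infixr 5 _⇒_
data Sort : Set where
  o   : Sort
  _⇒_ : Sort → Sort → Sort

data Flag : Set where
  pr np : Flag

𝔭 : ℕ → Flag
𝔭 zero    = np
𝔭 (suc _) = pr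

-- T^o = {r};  T^(α→β) = P({pr,np} × T^α) × T^β.
-- A finite set of pairs (f , τ) ∈ {pr,np} × T^α is represented canonically
-- by its characteristic bit vector over the (duplicate-free, complete)
-- enumeration  allPairs α  of {pr,np} × T^α.

data TyO : Set where
  r : TyO

allVecs : (k : ℕ) → List (Vec Bool k)
allVecs zero    = [] ∷ []
allVecs (suc k) = concatMap (λ v → (true ∷ v) ∷ (false ∷ v) ∷ []) (allVecs k)

mutual
  Ty : Sort → Set
  Ty o       = TyO
  Ty (α ⇒ β) = TySet α × Ty β     -- (S , τ) stands for ⋀_{(f,σ)∈S} (f,σ) → τ

  record TySet (α : Sort) : Set where
    inductive
    constructor ⟨_⟩
    field
      bits : Vec Bool (length (allPairs α))

  allPairs : (α : Sort) → List (Flag × Ty α)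
  allPairs α = cartesianProduct (pr ∷ np ∷ []) (allTy α)

  allTy : (σ : Sort) → List (Ty σ)
  allTy o       = r ∷ []
  allTy (α ⇒ β) = cartesianProduct (map ⟨_⟩ (allVecs (length (allPairs α)))) (allTy β)

members : {A : Set} (xs : List A) → Vec Bool (length xs) → List A
members []       []           = []
members (x ∷ xs) (true  ∷ bs) = x ∷ members xs bs
members (x ∷ xs) (false ∷ bs) = members xs bs

open TySet public

emptyˢ : {α : Sort} → TySet α
emptyˢ {α} = ⟨ replicate (length (allPairs α)) false ⟩

-- ⊤ : the empty conjunction
⊤ᵗ : {α : Sort} → TySet α
⊤ᵗ = emptyˢ

singleˢ : {α : Sort} → Fin (length (allPairs α)) → TySet α
singleˢ j = ⟨ tabulate (λ i → does (i Fin.≟ j)) ⟩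

_∪ˢ_ : {α : Sort} → TySet α → TySet α → TySet α
⟨ S ⟩ ∪ˢ ⟨ S' ⟩ = ⟨ zipWith _∨_ S S' ⟩

prOnly : {A : Set} (xs : List (Flag × A)) → Vec Bool (length xs) → Vec Bool (length xs)
prOnly []             []       = []
prOnly ((pr , _) ∷ xs) (b ∷ bs) = b ∷ prOnly xs bs
prOnly ((np , _) ∷ xs) (b ∷ bs) = false ∷ prOnly xs bs

countTrue : {k : ℕ} → Vec Bool k → ℕ
countTrue []           = 0
countTrue (true  ∷ bs) = suc (countTrue bs)
countTrue (false ∷ bs) = countTrue bs

-- An environment Γ (a finite set of bindings x : (g , σ)) over a variable
-- context Δ is given by, for each variable of Δ, the set of its bindings.

infix 4 _∋_
data _∋_ : List Sort → Sort → Set where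
  here  : {Δ : List Sort} {σ : Sort} → (σ ∷ Δ) ∋ σ
  there : {Δ : List Sort} {σ τ : Sort} → Δ ∋ σ → (τ ∷ Δ) ∋ σ

Ren : List Sort → List Sort → Set
Ren Δ Δ' = {σ : Sort} → Δ ∋ σ → Δ' ∋ σ

liftRen : {Δ Δ' : List Sort} {α : Sort} → Ren Δ Δ' → Ren (α ∷ Δ) (α ∷ Δ')
liftRen ρ here      = here
liftRen ρ (there x) = there (ρ x)

infixr 5 _∷_
data Env : List Sort → Set where
  []  : Env []
  _∷_ : {σ : Sort} {Δ : List Sort} → TySet σ → Env Δ → Env (σ ∷ Δ)

∅ : {Δ : List Sort} → Env Δ
∅ {[]}    = []
∅ {σ ∷ Δ} = emptyˢ ∷ ∅

infixl 6 _∪_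
_∪_ : {Δ : List Sort} → Env Δ → Env Δ → Env Δ
[]       ∪ []       = []
(S ∷ Γ) ∪ (S' ∷ Γ') = (S ∪ˢ S') ∷ (Γ ∪ Γ')

_↾pr : {Δ : List Sort} → Env Δ → Env Δ
[] ↾pr                = []
(_∷_ {σ} S Γ) ↾pr     = ⟨ prOnly (allPairs σ) (bits S) ⟩ ∷ (Γ ↾pr)

∣_∣ : {Δ : List Sort} → Env Δ → ℕ
∣ [] ∣    = 0
∣ S ∷ Γ ∣ = countTrue (bits S) + ∣ Γ ∣

-- the environment  x : (f , τ)  where (f , τ) is the j-th element of allPairs σ
sing : {Δ : List Sort} {σ : Sort} → Δ ∋ σ → Fin (length (allPairs σ)) → Env Δ
sing here      j = singleˢ j ∷ ∅
sing (there x) j = emptyˢ ∷ sing x j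

infixr 5 _◂_
_◂_ : {A : Set} {m : ℕ} → A → (Fin m → A) → Fin (suc m) → A
(x ◂ f) zero    = x
(x ◂ f) (suc i) = f i

∑ : {m : ℕ} → (Fin m → ℕ) → ℕ
∑ {zero}  f = 0
∑ {suc m} f = f zero + ∑ (λ i → f (suc i))

⋃ : {m : ℕ} {Δ : List Sort} → (Fin m → Env Δ) → Env Δ
⋃ {zero}  f = ∅
⋃ {suc m} f = f zero ∪ ⋃ (λ i → f (suc i))

dupl : {m : ℕ} {Δ : List Sort} → (Fin m → Env Δ) → ℕ
dupl Γs = ∑ (λ i → ∣ Γs i ↾pr ∣) ∸ ∣ ⋃ (λ i → Γs i ↾pr) ∣

module Terms {n : ℕ} (srt : Fin n → Sort) where

  -- one layer of a (simply-typed, de Bruijn) lambda-term over the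
  -- constants a, b, c, ω and the nonterminals (free variables Y)
  data Layer (S : List Sort → Sort → Set) (Δ : List Sort) : Sort → Set where
    var : {σ : Sort} → Δ ∋ σ → Layer S Δ σ
    lam : {α β : Sort} → S (α ∷ Δ) β → Layer S Δ (α ⇒ β)
    app : {α β : Sort} → S Δ (α ⇒ β) → S Δ α → Layer S Δ β
    a   : Layer S Δ (o ⇒ o)
    b   : Layer S Δ (o ⇒ o ⇒ o)
    c   : Layer S Δ o
    ω   : Layer S Δ o
    nt  : (Y : Fin n) → Layer S Δ (srt Y)

  data Tm (Δ : List Sort) (σ : Sort) : Set where
    wrap : Layer Tm Δ σ → Tm Δ σ

  -- possibly infinitary lambda-terms, presented as a state of a
  -- coalgebra of the layer functor (the term is its unfolding)
  record ITm (Δ : List Sort) (σ : Sort) : Set₁ where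
    field
      State : List Sort → Sort → Set
      step  : {Δ' : List Sort} {σ' : Sort} → State Δ' σ' → Layer State Δ' σ'
      root  : State Δ σ

  fin : {Δ : List Sort} {σ : Sort} → Tm Δ σ → ITm Δ σ
  fin t = record { State = Tm ; step = λ { (wrap l) → l } ; root = t }

  data LamFree {Δ : List Sort} : {σ : Sort} → Tm Δ σ → Set where
    var : {σ : Sort} (x : Δ ∋ σ) → LamFree (wrap (var x))
    app : {α β : Sort} {K : Tm Δ (α ⇒ β)} {L : Tm Δ α} →
          LamFree K → LamFree L → LamFree (wrap (app K L))
    a   : LamFree (wrap a)
    b   : LamFree (wrap b)
    c   : LamFree (wrap c)
    nt  : (Y : Fin n) → LamFree (wrap (nt Y))

  data LamPrefixed {Δ : List Sort} : {σ : Sort} → Tm Δ σ → Set where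
    body : {σ : Sort} {K : Tm Δ σ} → LamFree K → LamPrefixed K
    abs  : {α β : Sort} {t : Tm (α ∷ Δ) β} → LamPrefixed t → LamPrefixed (wrap (lam t))

  data IsNT {Δ : List Sort} : {σ : Sort} → Tm Δ σ → Set where
    isNT : (Y : Fin n) → IsNT (wrap (nt Y))

  Oracle : Set₁
  Oracle = (Y : Fin n) → Flag → Ty (srt Y) → Set

  noNT : Oracle
  noNT _ _ _ = ⊥

  -- The type system (finite derivations), over the states of a coalgebra.
  -- The oracle O supplies the additional nonterminal axioms
  --   ∅ ⊢ Y : (w , σ)   whenever  O Y (𝔭 w) σ.

  module Typing (O : Oracle) {St : List Sort → Sort → Set}
                (step : {Δ : List Sort} {σ : Sort} → St Δ σ → Layer St Δ σ) where

    data Der {Δ : List Sort} : {σ : Sort} → Env Δ → St Δ σ → ℕ → Ty σ → Set where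
      ax-a  : {s : St Δ (o ⇒ o)} → step s ≡ a →
              (j : Fin (length (allPairs o))) →
              Der ∅ s 1 (singleˢ j , r)
      ax-c  : {s : St Δ o} → step s ≡ c → Der ∅ s 0 r
      ax-b₁ : {s : St Δ (o ⇒ o ⇒ o)} → step s ≡ b →
              (j : Fin (length (allPairs o))) →
              Der ∅ s 0 (singleˢ j , (⊤ᵗ , r))
      ax-b₂ : {s : St Δ (o ⇒ o ⇒ o)} → step s ≡ b →
              (j : Fin (length (allPairs o))) →
              Der ∅ s 0 (⊤ᵗ , (singleˢ j , r))
      ax-var : {σ : Sort} {s : St Δ σ} {x : Δ ∋ σ} → step s ≡ var x →
              (j : Fin (length (allPairs σ))) →
              Der (sing x j) s 0 (proj₂ (lookup (allPairs σ) j))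
      ax-nt : {Y : Fin n} {s : St Δ (srt Y)} → step s ≡ nt Y →
              (w : ℕ) (τ : Ty (srt Y)) → O Y (𝔭 w) τ →
              Der ∅ s w τ
      rule-lam : {α β : Sort} {s : St Δ (α ⇒ β)} {K : St (α ∷ Δ) β} → step s ≡ lam K →
              {Γ : Env Δ} {S : TySet α} {v : ℕ} {τ : Ty β} →
              Der (S ∷ Γ) K v τ →
              Der Γ s v (S , τ)
      rule-app : {α β : Sort} {s : St Δ β} {K : St Δ (α ⇒ β)} {L : St Δ α} →
              step s ≡ app K L →
              {Γ₀ : Env Δ} {v₀ : ℕ} {S : TySet α} {τ : Ty β} →
              Der Γ₀ K v₀ (S , τ) →
              (Γs : Fin (length (members (allPairs α) (bits S))) → Env Δ) →
              (vs : Fin (length (members (allPairs α) (bits S))) → ℕ) →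
              ((i : Fin (length (members (allPairs α) (bits S)))) →
                 Der (Γs i) L (vs i) (proj₂ (lookup (members (allPairs α) (bits S)) i))) →
              ((i : Fin (length (members (allPairs α) (bits S)))) →
                 (proj₁ (lookup (members (allPairs α) (bits S)) i) ≡ pr) ⇔
                 (0 < vs i ⊎ (Γs i ↾pr) ≢ ∅)) →
              Der (⋃ (Γ₀ ◂ Γs)) s (dupl (Γ₀ ◂ Γs) + ∑ (v₀ ◂ vs)) τ

  _⊢[_]_∶_,_ : {Δ : List Sort} {σ : Sort} → Env Δ → Oracle → ITm Δ σ → ℕ → Ty σ → Set
  Γ ⊢[ O ] M ∶ v , τ = Typing.Der O (ITm.step M) Γ (ITm.root M) v τ

record Scheme : Set where
  field
    n        : ℕ
    srt      : Fin n → Sort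
    R        : (X : Fin n) → Terms.Tm srt [] (srt X)
    R-shape  : (X : Fin n) → Terms.LamPrefixed srt (R X)
    R-notNT  : (X : Fin n) → ¬ Terms.IsNT srt (R X)
    Xst      : Fin n
    Xst-sort : srt Xst ≡ o

module SchemeDefs (G : Scheme) where
  open Scheme G
  open Terms srt

  -- States are finite terms with a
  -- delayed renaming; a nonterminal Y is replaced by R(Y) (which is not a
  -- nonterminal, so every step produces a layer that is not a nonterminal).
  UState : List Sort → Sort → Set
  UState Δ σ = Σ (List Sort) (λ Δ' → Tm Δ' σ × Ren Δ' Δ)

  private
    layer : {Δ' Δ : List Sort} {σ : Sort} (t : Tm Δ' σ) → ¬ IsNT t → Ren Δ' Δ → Layer UState Δ σ
    layer (wrap (var x))   _ ρ = var (ρ x)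
    layer (wrap (lam t))   _ ρ = lam (_ , t , liftRen ρ)
    layer (wrap (app s t)) _ ρ = app (_ , s , ρ) (_ , t , ρ)
    layer (wrap a)         _ ρ = a
    layer (wrap b)         _ ρ = b
    layer (wrap c)         _ ρ = c
    layer (wrap ω)         _ ρ = ω
    layer (wrap (nt Y))    p ρ = ⊥-elim (p (isNT Y))

    noVar : {Δ : List Sort} → Ren [] Δ
    noVar ()

  ustep : {Δ : List Sort} {σ : Sort} → UState Δ σ → Layer UState Δ σ
  ustep (_ , wrap (nt Y) , _) = layer (R Y) (R-notNT Y) noVar
  ustep (_ , t@(wrap (var _))   , ρ) = layer t (λ ()) ρ
  ustep (_ , t@(wrap (lam _))   , ρ) = layer t (λ ()) ρ
  ustep (_ , t@(wrap (app _ _)) , ρ) = layer t (λ ()) ρ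
  ustep (_ , t@(wrap a)         , ρ) = layer t (λ ()) ρ
  ustep (_ , t@(wrap b)         , ρ) = layer t (λ ()) ρ
  ustep (_ , t@(wrap c)         , ρ) = layer t (λ ()) ρ
  ustep (_ , t@(wrap ω)         , ρ) = layer t (λ ()) ρ

  Λ : {σ : Sort} → Tm [] σ → ITm [] σ
  Λ M = record { State = UState ; step = ustep ; root = ([] , M , λ x → x) }

  ΛG : (X : Fin n) → ITm [] (srt X)
  ΛG X = Λ (wrap (nt X))

  data 𝒯 : (X : Fin n) → Flag → Ty (srt X) → Set where
    intro : {X : Fin n} {v : ℕ} {τ : Ty (srt X)} →
            ∅ ⊢[ 𝒯 ] fin (R X) ∶ v , τ →
            𝒯 X (𝔭 v) τ

{-# OPTIONS --safe #-}
-- The unfolding Λ(X) agrees with the body R(X) layer by layer, except that a nonterminal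
-- occurrence Y in a body is continued in Λ(X) by the layers of R(Y). Bodies are closed, so a
-- subterm of a body sits in Λ(X) under an extension of its context by outer binders, and the
-- environments correspond by padding with empty binding sets, which commutes with ∪, ↾pr and
-- sizes, hence with dupl. A 𝒯-derivation for R(X) becomes a derivation for Λ(X) by replacing
-- each axiom Y : (w , σ) with the derivation for Λ(Y) given by induction on 𝒯; its value may
-- differ from w, but only within the sign 𝔭, and rule (@) uses the values of its premises only
-- through their signs, in its side conditions and in the sign of its conclusion. Conversely a
-- derivation for Λ(X) is cut at every nonterminal occurrence Y, where by induction the
-- remaining derivation yields Y : (𝔭 v , σ) ∈ 𝒯, used as an axiom with the same value v.

module Submission where

open import Defs
open import Data.Nat using (ℕ; zero; suc; _+_; _∸_; _<_; s≤s; z≤n)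
open import Data.Fin using (Fin; zero; suc)
open import Data.Product using (Σ; _×_; _,_; proj₁; proj₂)
open import Data.Sum using (_⊎_)
open import Data.List using (List; []; _∷_; length; lookup)
open import Data.List.Relation.Binary.Prefix.Heterogeneous using (Prefix; []; _∷_)
open import Data.Vec using (_∷_; replicate)
open import Data.Vec.Properties using (zipWith-identityˡ)
open import Data.Bool using (false)
open import Data.Bool.Properties using (∨-identityˡ)
open import Data.Sum.Function.Propositional using (_⊎-⇔_)
open import Data.Empty using (⊥-elim)
open import Relation.Binary.PropositionalEquality using (_≡_; _≢_; refl; sym; trans; cong; cong₂; subst)
open import Function.Bundles using (_⇔_; mk⇔)
open import Function.Related.TypeIsomorphisms using (¬-cong-⇔)
import Function.Properties.Equivalence as ⇔

∪-identityˡ : {Δ : List Sort} (Γ : Env Δ) → ∅ ∪ Γ ≡ Γ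
∪-identityˡ []          = refl
∪-identityˡ (⟨ S ⟩ ∷ Γ) = cong₂ _∷_ (cong ⟨_⟩ (zipWith-identityˡ ∨-identityˡ S)) (∪-identityˡ Γ)

prOnly-replicate-false : {A : Set} (xs : List (Flag × A)) →
                         prOnly xs (replicate (length xs) false) ≡ replicate (length xs) false
prOnly-replicate-false []             = refl
prOnly-replicate-false ((pr , _) ∷ xs) = cong (false ∷_) (prOnly-replicate-false xs)
prOnly-replicate-false ((np , _) ∷ xs) = cong (false ∷_) (prOnly-replicate-false xs)

countTrue-replicate-false : (k : ℕ) → countTrue (replicate k false) ≡ 0
countTrue-replicate-false zero    = refl
countTrue-replicate-false (suc k) = countTrue-replicate-false k

∅↾pr : {Δ : List Sort} → ∅ {Δ} ↾pr ≡ ∅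
∅↾pr {[]}    = refl
∅↾pr {σ ∷ Δ} = cong₂ _∷_ (cong ⟨_⟩ (prOnly-replicate-false (allPairs σ))) ∅↾pr

∣∅∣ : {Δ : List Sort} → ∣ ∅ {Δ} ∣ ≡ 0
∣∅∣ {[]}    = refl
∣∅∣ {σ ∷ Δ} = cong₂ _+_ (countTrue-replicate-false (length (allPairs σ))) (∣∅∣ {Δ})

∑-cong : {m : ℕ} {f g : Fin m → ℕ} → (∀ i → f i ≡ g i) → ∑ f ≡ ∑ g
∑-cong {zero}  eq = refl
∑-cong {suc m} eq = cong₂ _+_ (eq zero) (∑-cong (λ i → eq (suc i)))

⋃-cong : {m : ℕ} {Δ : List Sort} {F G : Fin m → Env Δ} → (∀ i → F i ≡ G i) → ⋃ F ≡ ⋃ G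
⋃-cong {zero}  eq = refl
⋃-cong {suc m} eq = cong₂ _∪_ (eq zero) (⋃-cong (λ i → eq (suc i)))

dupl-cong : {m : ℕ} {Δ : List Sort} {F G : Fin m → Env Δ} → (∀ i → F i ≡ G i) → dupl F ≡ dupl G
dupl-cong eq = cong₂ _∸_ (∑-cong (λ i → cong (λ Γ → ∣ Γ ↾pr ∣) (eq i)))
                         (cong ∣_∣ (⋃-cong (λ i → cong _↾pr (eq i))))

infix 4 _⊑_
_⊑_ : List Sort → List Sort → Set
_⊑_ = Prefix _≡_

inject : {Δ' Δ : List Sort} → Δ' ⊑ Δ → Ren Δ' Δ
inject (refl ∷ e) here      = here
inject (refl ∷ e) (there x) = there (inject e x)

weaken : {Δ' Δ : List Sort} → Δ' ⊑ Δ → Env Δ' → Env Δ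
weaken []         []      = ∅
weaken (refl ∷ e) (S ∷ Γ) = S ∷ weaken e Γ

-- States of the unfolding store renamings as functions; lacking function extensionality,
-- they are compared pointwise with the embedding of a prefix.
infix 4 _≗ᴿ_
_≗ᴿ_ : {Δ' Δ : List Sort} → Ren Δ' Δ → Δ' ⊑ Δ → Set
_≗ᴿ_ {Δ'} ρ e = {σ : Sort} (x : Δ' ∋ σ) → ρ x ≡ inject e x

liftRen-≗ᴿ : {Δ' Δ : List Sort} {α : Sort} {ρ : Ren Δ' Δ} {e : Δ' ⊑ Δ} →
             ρ ≗ᴿ e → liftRen {α = α} ρ ≗ᴿ refl ∷ e
liftRen-≗ᴿ h here      = refl
liftRen-≗ᴿ h (there x) = cong there (h x)

weaken-∅ : {Δ' Δ : List Sort} (e : Δ' ⊑ Δ) → weaken e ∅ ≡ ∅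
weaken-∅ []         = refl
weaken-∅ (refl ∷ e) = cong (emptyˢ ∷_) (weaken-∅ e)

weaken-∪ : {Δ' Δ : List Sort} (e : Δ' ⊑ Δ) (Γ₁ Γ₂ : Env Δ') →
           weaken e (Γ₁ ∪ Γ₂) ≡ weaken e Γ₁ ∪ weaken e Γ₂
weaken-∪ []         []       []        = sym (∪-identityˡ ∅)
weaken-∪ (refl ∷ e) (S ∷ Γ₁) (S' ∷ Γ₂) = cong ((S ∪ˢ S') ∷_) (weaken-∪ e Γ₁ Γ₂)

weaken-↾pr : {Δ' Δ : List Sort} (e : Δ' ⊑ Δ) (Γ : Env Δ') → weaken e (Γ ↾pr) ≡ weaken e Γ ↾pr
weaken-↾pr []         []      = sym ∅↾pr
weaken-↾pr (refl ∷ e) (S ∷ Γ) = cong (_ ∷_) (weaken-↾pr e Γ)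

∣weaken∣ : {Δ' Δ : List Sort} (e : Δ' ⊑ Δ) (Γ : Env Δ') → ∣ weaken e Γ ∣ ≡ ∣ Γ ∣
∣weaken∣ {Δ = Δ} []  []      = ∣∅∣ {Δ}
∣weaken∣ (refl ∷ e) (S ∷ Γ) = cong (countTrue (bits S) +_) (∣weaken∣ e Γ)

weaken-sing : {Δ' Δ : List Sort} {σ : Sort} (e : Δ' ⊑ Δ) (x : Δ' ∋ σ)
              (j : Fin (length (allPairs σ))) →
              weaken e (sing x j) ≡ sing (inject e x) j
weaken-sing (refl ∷ e) here      j = cong (singleˢ j ∷_) (weaken-∅ e)
weaken-sing (refl ∷ e) (there x) j = cong (emptyˢ ∷_) (weaken-sing e x j)

weaken-injective : {Δ' Δ : List Sort} (e : Δ' ⊑ Δ) (Γ₁ Γ₂ : Env Δ') →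
                   weaken e Γ₁ ≡ weaken e Γ₂ → Γ₁ ≡ Γ₂
weaken-injective []         []       []       _  = refl
weaken-injective (refl ∷ e) (S ∷ Γ₁) (S' ∷ Γ₂) eq =
  cong₂ _∷_ (cong head eq) (weaken-injective e Γ₁ Γ₂ (cong tail eq))
  where
    head : {σ : Sort} {Δ : List Sort} → Env (σ ∷ Δ) → TySet σ
    head (S ∷ _) = S
    tail : {σ : Sort} {Δ : List Sort} → Env (σ ∷ Δ) → Env Δ
    tail (_ ∷ Γ) = Γ

weaken-⋃ : {Δ' Δ : List Sort} {m : ℕ} (e : Δ' ⊑ Δ) (F : Fin m → Env Δ') →
           weaken e (⋃ F) ≡ ⋃ (λ i → weaken e (F i))
weaken-⋃ {m = zero}  e F = weaken-∅ e
weaken-⋃ {m = suc m} e F =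
  trans (weaken-∪ e (F zero) _) (cong (weaken e (F zero) ∪_) (weaken-⋃ e (λ i → F (suc i))))

dupl-weaken : {Δ' Δ : List Sort} {m : ℕ} (e : Δ' ⊑ Δ) (F : Fin m → Env Δ') →
              dupl (λ i → weaken e (F i)) ≡ dupl F
dupl-weaken {Δ'} e F = cong₂ _∸_ (∑-cong (λ i → ∣weaken↾pr∣ (F i)))
                                  (trans (cong ∣_∣ (sym weaken-⋃↾pr)) (∣weaken∣ e _))
  where
    ∣weaken↾pr∣ : (Γ : Env Δ') → ∣ weaken e Γ ↾pr ∣ ≡ ∣ Γ ↾pr ∣
    ∣weaken↾pr∣ Γ = trans (cong ∣_∣ (sym (weaken-↾pr e Γ))) (∣weaken∣ e (Γ ↾pr))
    weaken-⋃↾pr : weaken e (⋃ (λ i → F i ↾pr)) ≡ ⋃ (λ i → weaken e (F i) ↾pr)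
    weaken-⋃↾pr = trans (weaken-⋃ e (λ i → F i ↾pr)) (⋃-cong (λ i → weaken-↾pr e (F i)))

𝔭-+ : {a a' b b' : ℕ} → 𝔭 a ≡ 𝔭 a' → 𝔭 b ≡ 𝔭 b' → 𝔭 (a + b) ≡ 𝔭 (a' + b')
𝔭-+ {zero}  {zero}  _ q = q
𝔭-+ {suc _} {suc _} _ _ = refl

𝔭-∑ : {m : ℕ} {f g : Fin m → ℕ} → (∀ i → 𝔭 (f i) ≡ 𝔭 (g i)) → 𝔭 (∑ f) ≡ 𝔭 (∑ g)
𝔭-∑ {zero}  eq = refl
𝔭-∑ {suc m} eq = 𝔭-+ (eq zero) (𝔭-∑ (λ i → eq (suc i)))

𝔭-positive : {a b : ℕ} → 𝔭 a ≡ 𝔭 b → (0 < a) ⇔ (0 < b)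
𝔭-positive {zero}  {zero}  _ = ⇔.refl
𝔭-positive {suc _} {suc _} _ = mk⇔ (λ _ → s≤s z≤n) (λ _ → s≤s z≤n)

Productive : {Δ : List Sort} → ℕ → Env Δ → Set
Productive v Γ = 0 < v ⊎ Γ ↾pr ≢ ∅

weaken↾pr≡∅ : {Δ' Δ : List Sort} (e : Δ' ⊑ Δ) (Γ : Env Δ') → (weaken e Γ ↾pr ≡ ∅) ⇔ (Γ ↾pr ≡ ∅)
weaken↾pr≡∅ e Γ = mk⇔
  (λ p → weaken-injective e _ _ (trans (weaken-↾pr e Γ) (trans p (sym (weaken-∅ e)))))
  (λ q → trans (sym (weaken-↾pr e Γ)) (trans (cong (weaken e) q) (weaken-∅ e)))

productive-weaken : {Δ' Δ : List Sort} {v v' : ℕ} (e : Δ' ⊑ Δ) (Γ : Env Δ') →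
                    𝔭 v ≡ 𝔭 v' → Productive v Γ ⇔ Productive v' (weaken e Γ)
productive-weaken e Γ sign = 𝔭-positive sign ⊎-⇔ ¬-cong-⇔ (⇔.sym (weaken↾pr≡∅ e Γ))

module Unfolding (G : Scheme) where
  open Scheme G
  open Terms srt
  open SchemeDefs G
  open Typing

  DerΛ : {Δ : List Sort} {σ : Sort} → Env Δ → UState Δ σ → ℕ → Ty σ → Set
  DerΛ = Der noNT ustep

  -- The step of fin (R X) does not depend on X, but not definitionally so: X has to be
  -- passed along explicitly.
  DerR : (X : Fin n) {Δ : List Sort} {σ : Sort} → Env Δ → Tm Δ σ → ℕ → Ty σ → Set
  DerR X = Der 𝒯 (ITm.step (fin (R X)))

  Args : {α : Sort} → TySet α → Set
  Args {α} S = Fin (length (members (allPairs α) (bits S)))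

  premise : {α : Sort} (S : TySet α) → Args S → Flag × Ty α
  premise {α} S i = lookup (members (allPairs α) (bits S)) i

  data Matches {Δ' Δ : List Sort} (e : Δ' ⊑ Δ) : {σ : Sort} → Layer UState Δ σ → Tm Δ' σ → Set where
    var : {σ : Sort} (x : Δ' ∋ σ) → Matches e (var (inject e x)) (wrap (var x))
    lam : {α β : Sort} {t : Tm (α ∷ Δ') β} {ρ : Ren (α ∷ Δ') (α ∷ Δ)} →
          ρ ≗ᴿ refl ∷ e → Matches e (lam (α ∷ Δ' , t , ρ)) (wrap (lam t))
    app : {α β : Sort} {t₁ : Tm Δ' (α ⇒ β)} {t₂ : Tm Δ' α} {ρ : Ren Δ' Δ} →
          ρ ≗ᴿ e → Matches e (app (Δ' , t₁ , ρ) (Δ' , t₂ , ρ)) (wrap (app t₁ t₂))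
    a : Matches e a (wrap a)
    b : Matches e b (wrap b)
    c : Matches e c (wrap c)
    ω : Matches e ω (wrap ω)

  -- Matches is inverted on the layer, Unfolds computes on the term: the direction from Λ
  -- learns the layer from its derivation, the direction to Λ learns the term.
  Unfolds : {Δ' Δ : List Sort} {σ : Sort} → Δ' ⊑ Δ → Tm Δ' σ → Layer UState Δ σ → Set
  Unfolds e (wrap (nt Y)) l = Matches [] l (R Y)
  Unfolds e t             l = Matches e l t

  matches⇒unfolds : {Δ' Δ : List Sort} {σ : Sort} {e : Δ' ⊑ Δ} {l : Layer UState Δ σ}
                    {t : Tm Δ' σ} → Matches e l t → Unfolds e t l
  matches⇒unfolds (var x) = var x
  matches⇒unfolds (lam h) = lam h
  matches⇒unfolds (app h) = app h
  matches⇒unfolds a       = a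
  matches⇒unfolds b       = b
  matches⇒unfolds c       = c
  matches⇒unfolds ω       = ω

  ustep-nt-matches : {Δ' Δ : List Sort} (Y : Fin n) (ρ : Ren Δ' Δ) →
                     Matches [] (ustep (Δ' , wrap (nt Y) , ρ)) (R Y)
  ustep-nt-matches Y ρ with srt Y | R Y | R-notNT Y
  ... | _ | wrap (var ())    | _
  ... | _ | wrap (lam t)     | _     = lam λ { here → refl ; (there ()) }
  ... | _ | wrap (app t₁ t₂) | _     = app λ ()
  ... | _ | wrap a           | _     = a
  ... | _ | wrap b           | _     = b
  ... | _ | wrap c           | _     = c
  ... | _ | wrap ω           | _     = ω
  ... | _ | wrap (nt Z)      | notNT = ⊥-elim (notNT (isNT Z))

  ustep-unfolds : {Δ' Δ : List Sort} {σ : Sort} {e : Δ' ⊑ Δ} {ρ : Ren Δ' Δ} →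
                  ρ ≗ᴿ e → (t : Tm Δ' σ) → Unfolds e t (ustep (Δ' , t , ρ))
  ustep-unfolds {e = e} h (wrap (var x)) =
    subst (λ y → Matches e (var y) (wrap (var x))) (sym (h x)) (var x)
  ustep-unfolds         h (wrap (lam t))     = lam (liftRen-≗ᴿ h)
  ustep-unfolds         h (wrap (app t₁ t₂)) = app h
  ustep-unfolds         h (wrap a)           = a
  ustep-unfolds         h (wrap b)           = b
  ustep-unfolds         h (wrap c)           = c
  ustep-unfolds         h (wrap ω)           = ω
  ustep-unfolds {ρ = ρ} h (wrap (nt Y))      = ustep-nt-matches Y ρ

  Der𝔭 : {Δ : List Sort} {σ : Sort} → Env Δ → UState Δ σ → Flag → Ty σ → Set
  Der𝔭 Γ s f τ = Σ ℕ λ v → 𝔭 v ≡ f × DerΛ Γ s v τ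

  body⇒unfolding-app : {Δ' Δ : List Sort} {α β : Sort} (e : Δ' ⊑ Δ) {s : UState Δ β}
                       {K : Tm Δ' (α ⇒ β)} {L : Tm Δ' α} {ρ : Ren Δ' Δ}
                       {Γ₀ : Env Δ'} {v₀ : ℕ} {S : TySet α} {τ : Ty β} →
                       ustep s ≡ app (Δ' , K , ρ) (Δ' , L , ρ) →
                       Der𝔭 (weaken e Γ₀) (Δ' , K , ρ) (𝔭 v₀) (S , τ) →
                       (Γs : Args S → Env Δ') (vs : Args S → ℕ) →
                       (∀ i → Der𝔭 (weaken e (Γs i)) (Δ' , L , ρ) (𝔭 (vs i)) (proj₂ (premise S i))) →
                       (∀ i → (proj₁ (premise S i) ≡ pr) ⇔ Productive (vs i) (Γs i)) →
                       Der𝔭 (weaken e (⋃ (Γ₀ ◂ Γs))) s (𝔭 (dupl (Γ₀ ◂ Γs) + ∑ (v₀ ◂ vs))) τ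
  body⇒unfolding-app e {s} {Γ₀ = Γ₀} {v₀} {S} {τ} eq (v₀' , sign₀ , d₀) Γs vs args flags =
    v , 𝔭-+ (cong 𝔭 (dupl-weaken e (Γ₀ ◂ Γs))) (𝔭-∑ signs) ,
    subst (λ Γ → DerΛ Γ s v τ) (sym (weaken-⋃ e (Γ₀ ◂ Γs)))
      (rule-app eq d₀ (λ i → weaken e (Γs i)) vs' (λ i → proj₂ (proj₂ (args i)))
        (λ i → ⇔.trans (flags i) (productive-weaken e (Γs i) (sym (proj₁ (proj₂ (args i)))))))
    where
      vs' : Args S → ℕ
      vs' i = proj₁ (args i)
      v : ℕ
      v = dupl (λ i → weaken e ((Γ₀ ◂ Γs) i)) + ∑ (v₀' ◂ vs')
      signs : ∀ i → 𝔭 ((v₀' ◂ vs') i) ≡ 𝔭 ((v₀ ◂ vs) i)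
      signs zero    = sign₀
      signs (suc i) = proj₁ (proj₂ (args i))

  mutual
    body⇒unfolding : {X : Fin n} {Δ' Δ : List Sort} {σ : Sort} {e : Δ' ⊑ Δ} {Γ : Env Δ'}
                     {t : Tm Δ' σ} {v : ℕ} {τ : Ty σ} {s : UState Δ σ} {l : Layer UState Δ σ} →
                     DerR X Γ t v τ → ustep s ≡ l → Unfolds e t l → Der𝔭 (weaken e Γ) s (𝔭 v) τ
    body⇒unfolding {e = e} {t = wrap _} (ax-a refl j) eq a rewrite weaken-∅ e = 1 , refl , ax-a eq j
    body⇒unfolding {e = e} {t = wrap _} (ax-c refl) eq c rewrite weaken-∅ e = 0 , refl , ax-c eq
    body⇒unfolding {e = e} {t = wrap _} (ax-b₁ refl j) eq b rewrite weaken-∅ e = 0 , refl , ax-b₁ eq j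
    body⇒unfolding {e = e} {t = wrap _} (ax-b₂ refl j) eq b rewrite weaken-∅ e = 0 , refl , ax-b₂ eq j
    body⇒unfolding {e = e} {t = wrap _} (ax-var {x = x} refl j) eq (var x) rewrite weaken-sing e x j =
      0 , refl , ax-var eq j
    body⇒unfolding {e = e} {t = wrap _} (ax-nt refl _ _ p) eq m rewrite weaken-∅ e = 𝒯⇒unfolding p eq m
    body⇒unfolding {X} {t = wrap _} (rule-lam {K = K} refl dK) eq (lam h)
      with v , sign , d ← body⇒unfolding {X} dK refl (ustep-unfolds h K) = v , sign , rule-lam eq d
    body⇒unfolding {X} {e = e} {t = wrap _} (rule-app {K = K} {L = L} refl dK Γs vs ds flags) eq
      (app h) =
      body⇒unfolding-app e eq (body⇒unfolding {X} dK refl (ustep-unfolds h K)) Γs vs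
        (λ i → body⇒unfolding {X} (ds i) refl (ustep-unfolds h L)) flags

    𝒯⇒unfolding : {Y : Fin n} {f : Flag} {τ : Ty (srt Y)} {Δ : List Sort}
                  {s : UState Δ (srt Y)} {l : Layer UState Δ (srt Y)} →
                  𝒯 Y f τ → ustep s ≡ l → Matches [] l (R Y) → Der𝔭 ∅ s f τ
    𝒯⇒unfolding {Y} (intro d) eq m = body⇒unfolding {Y} d eq (matches⇒unfolds m)

  Der⊑ : (X : Fin n) {Δ' Δ : List Sort} {σ : Sort} → Δ' ⊑ Δ → Env Δ → Tm Δ' σ → ℕ → Ty σ → Set
  Der⊑ X {Δ'} e Γ t v τ = Σ (Env Δ') λ Γ' → weaken e Γ' ≡ Γ × DerR X Γ' t v τ

  unfolding⇒body-app : {X : Fin n} {Δ' Δ : List Sort} {α β : Sort} (e : Δ' ⊑ Δ)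
                       {t₁ : Tm Δ' (α ⇒ β)} {t₂ : Tm Δ' α}
                       {Γ₀ : Env Δ} {v₀ : ℕ} {S : TySet α} {τ : Ty β} →
                       Der⊑ X e Γ₀ t₁ v₀ (S , τ) →
                       (Γs : Args S → Env Δ) (vs : Args S → ℕ) →
                       (∀ i → Der⊑ X e (Γs i) t₂ (vs i) (proj₂ (premise S i))) →
                       (∀ i → (proj₁ (premise S i) ≡ pr) ⇔ Productive (vs i) (Γs i)) →
                       Der⊑ X e (⋃ (Γ₀ ◂ Γs)) (wrap (app t₁ t₂)) (dupl (Γ₀ ◂ Γs) + ∑ (v₀ ◂ vs)) τ
  unfolding⇒body-app {X} {Δ'} e {t₁} {t₂} {Γ₀} {v₀} {S} {τ} (Γ₀' , w₀ , d₀) Γs vs args flags =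
    ⋃ Γs' ,
    trans (weaken-⋃ e Γs') (sym (⋃-cong weakens)) ,
    subst (λ k → DerR X (⋃ Γs') (wrap (app t₁ t₂)) (k + ∑ (v₀ ◂ vs)) τ)
      (sym (trans (dupl-cong weakens) (dupl-weaken e Γs')))
      (rule-app refl d₀ (λ i → proj₁ (args i)) vs (λ i → proj₂ (proj₂ (args i))) flags')
    where
      Γs' : Fin _ → Env Δ'
      Γs' = Γ₀' ◂ λ i → proj₁ (args i)
      weakens : ∀ i → (Γ₀ ◂ Γs) i ≡ weaken e (Γs' i)
      weakens zero    = sym w₀
      weakens (suc i) = sym (proj₁ (proj₂ (args i)))
      flags' : ∀ i → (proj₁ (premise S i) ≡ pr) ⇔ Productive (vs i) (proj₁ (args i))
      flags' i = ⇔.trans (subst (λ Γ → _ ⇔ Productive (vs i) Γ) (weakens (suc i)) (flags i))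
                         (⇔.sym (productive-weaken e (proj₁ (args i)) refl))

  mutual
    unfolding⇒body : {X : Fin n} {Δ' Δ : List Sort} {σ : Sort} {e : Δ' ⊑ Δ} {Γ : Env Δ}
                     {s : UState Δ σ} {v : ℕ} {τ : Ty σ} {t : Tm Δ' σ} →
                     DerΛ Γ s v τ → Unfolds e t (ustep s) → Der⊑ X e Γ t v τ
    unfolding⇒body {e = e} {t = wrap (nt Y)} d m
      with [] , refl , d' ← unfolding⇒body-layer {Y} d refl m =
      ∅ , weaken-∅ e , ax-nt refl _ _ (intro d')
    unfolding⇒body {X} {t = wrap (var x)}     d m = unfolding⇒body-layer {X} d refl m
    unfolding⇒body {X} {t = wrap (lam t)}     d m = unfolding⇒body-layer {X} d refl m
    unfolding⇒body {X} {t = wrap (app t₁ t₂)} d m = unfolding⇒body-layer {X} d refl m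
    unfolding⇒body {X} {t = wrap a}           d m = unfolding⇒body-layer {X} d refl m
    unfolding⇒body {X} {t = wrap b}           d m = unfolding⇒body-layer {X} d refl m
    unfolding⇒body {X} {t = wrap c}           d m = unfolding⇒body-layer {X} d refl m
    unfolding⇒body {X} {t = wrap ω}           d m = unfolding⇒body-layer {X} d refl m

    unfolding⇒body-layer : {X : Fin n} {Δ' Δ : List Sort} {σ : Sort} {e : Δ' ⊑ Δ} {Γ : Env Δ}
                           {s : UState Δ σ} {v : ℕ} {τ : Ty σ} {t : Tm Δ' σ}
                           {l : Layer UState Δ σ} →
                           DerΛ Γ s v τ → ustep s ≡ l → Matches e l t → Der⊑ X e Γ t v τ
    unfolding⇒body-layer (ax-a eq j) step≡l m with trans (sym step≡l) eq
    unfolding⇒body-layer {e = e} (ax-a eq j) step≡l a | refl = ∅ , weaken-∅ e , ax-a refl j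
    unfolding⇒body-layer (ax-c eq) step≡l m with trans (sym step≡l) eq
    unfolding⇒body-layer {e = e} (ax-c eq) step≡l c | refl = ∅ , weaken-∅ e , ax-c refl
    unfolding⇒body-layer (ax-b₁ eq j) step≡l m with trans (sym step≡l) eq
    unfolding⇒body-layer {e = e} (ax-b₁ eq j) step≡l b | refl = ∅ , weaken-∅ e , ax-b₁ refl j
    unfolding⇒body-layer (ax-b₂ eq j) step≡l m with trans (sym step≡l) eq
    unfolding⇒body-layer {e = e} (ax-b₂ eq j) step≡l b | refl = ∅ , weaken-∅ e , ax-b₂ refl j
    unfolding⇒body-layer (ax-var eq j) step≡l m with trans (sym step≡l) eq
    unfolding⇒body-layer {e = e} (ax-var eq j) step≡l (var x) | refl =
      sing x j , weaken-sing e x j , ax-var refl j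
    unfolding⇒body-layer (ax-nt _ _ _ ())
    unfolding⇒body-layer (rule-lam eq dK) step≡l m with trans (sym step≡l) eq
    unfolding⇒body-layer {X} (rule-lam eq dK) step≡l (lam {t = t} h) | refl
      with S ∷ Γ' , refl , d ← unfolding⇒body {X} dK (ustep-unfolds h t) =
      Γ' , refl , rule-lam refl d
    unfolding⇒body-layer (rule-app eq dK Γs vs ds flags) step≡l m with trans (sym step≡l) eq
    unfolding⇒body-layer {X} {e = e} (rule-app eq dK Γs vs ds flags) step≡l (app {t₁ = t₁} {t₂} h)
      | refl =
      unfolding⇒body-app {X} e (unfolding⇒body {X} dK (ustep-unfolds h t₁)) Γs vs
        (λ i → unfolding⇒body {X} (ds i) (ustep-unfolds h t₂)) flags

  𝒯⇒Λ : {X : Fin n} {f : Flag} {τ : Ty (srt X)} → 𝒯 X f τ → Der𝔭 ∅ (ITm.root (ΛG X)) f τ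
  𝒯⇒Λ {X} p = 𝒯⇒unfolding p refl (ustep-nt-matches X (λ x → x))

  Λ⇒𝒯 : {X : Fin n} {v : ℕ} {τ : Ty (srt X)} → DerΛ ∅ (ITm.root (ΛG X)) v τ → 𝒯 X (𝔭 v) τ
  Λ⇒𝒯 {X} d with [] , _ , d' ← unfolding⇒body-layer {X} d refl (ustep-nt-matches X (λ x → x)) =
    intro d'

lemma6 : (G : Scheme) (X : Fin (Scheme.n G)) (f : Flag) (τ : Ty (Scheme.srt G X)) →
    (Σ ℕ (λ v → (𝔭 v ≡ f) × Terms._⊢[_]_∶_,_ (Scheme.srt G) ∅ (Terms.noNT (Scheme.srt G)) (SchemeDefs.ΛG G X) v τ))
      ⇔ SchemeDefs.𝒯 G X f τ
lemma6 G X f τ = mk⇔ (λ { (v , refl , d) → Λ⇒𝒯 d }) 𝒯⇒Λ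
  where open Unfolding G
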